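{- For partitions $P_1,P_2,P,Q$ of a nonempty set $U$: (C1) $P_1\perp P_2\mid P_2$; (C2) $P_1\perp P_2\mid P$ implies $P_2\perp P_1\mid P$; (C3) $P_1\perp P_2\mid P$ and $Q\le P_2$ imply $P_1\perp Q\mid P$; (C4) $P_1\perp P_2\mid P$ implies $P_1\perp P_2\vee P\mid P$.
   Context: Partitions of $U$ are ordered by $P\le Q$ ($Q$ finer than $P$) iff every block of $Q$ is contained in a block of $P$. The join $P\vee Q$ is the partition whose blocks are the nonempty sets $B\cap C$ with $B$ a block of $P$ and $C$ a block of $Q$. For partitions $P_1,P_2,P$, $P_1\perp P_2\mid P$ means: for every block $B$ of $P$, every block $B_1$ of $P_1$ and every block $B_2$ of $P_2$ with $B_1\cap B\ne\emptyset$ and $B_2\cap B\ne\emptyset$, we have $B_1\cap B_2\cap B\ne\emptyset$. -}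

module Defs where

open import Data.Product using (Σ; ∃; _×_; _,_; proj₁; proj₂)
open import Function.Bundles using (_⇔_; mk⇔; Equivalence)

record Partition (U : Set) : Set₁ where
  field
    Idx      : Set
    blk      : Idx → U → Set
    nonempty : ∀ i → ∃ λ x → blk i x
    cover    : ∀ x → ∃ λ i → blk i x
    disjoint : ∀ i j x → blk i x → blk j x → ∀ y → (blk i y ⇔ blk j y)
open Partition public

-- Q ≤ P  iff  every block of P is contained in some block of Q (P is finer).
_≤ₚ_ : {U : Set} → Partition U → Partition U → Set
_≤ₚ_ P Q = ∀ (j : Idx Q) → ∃ λ (i : Idx P) → ∀ x → blk Q j x → blk P i x

_∨ₚ_ : {U : Set} → Partition U → Partition U → Partition U
_∨ₚ_ {U} P Q = record
  { Idx = Σ (Idx P × Idx Q) (λ ij → ∃ λ x → blk P (proj₁ ij) x × blk Q (proj₂ ij) x)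
  ; blk = λ k x → blk P (proj₁ (proj₁ k)) x × blk Q (proj₂ (proj₁ k)) x
  ; nonempty = λ k → proj₂ k
  ; cover = λ x → let (i , bi) = cover P x ; (j , cj) = cover Q x
                  in ((i , j) , x , bi , cj) , bi , cj
  ; disjoint = λ { ((i , j) , _) ((i' , j') , _) x (bi , cj) (bi' , cj') y →
      let e1 = disjoint P i i' x bi bi' y ; e2 = disjoint Q j j' x cj cj' y
      in mk⇔ (λ { (a , b) → Equivalence.to e1 a , Equivalence.to e2 b })
             (λ { (a , b) → Equivalence.from e1 a , Equivalence.from e2 b }) }
  }

Indep : {U : Set} → Partition U → Partition U → Partition U → Set
Indep P₁ P₂ P =
  ∀ (b : Idx P) (b₁ : Idx P₁) (b₂ : Idx P₂) →
  (∃ λ x → blk P₁ b₁ x × blk P b x) →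
  (∃ λ x → blk P₂ b₂ x × blk P b x) →
  ∃ λ x → blk P₁ b₁ x × blk P₂ b₂ x × blk P b x

module Submission where

open import Defs
open import Data.Product using (_×_; _,_)
open import Function.Bundles using (Equivalence)

blk-transport : {U : Set} (P : Partition U) {i j : Idx P} {x : U} →
  blk P i x → blk P j x → ∀ {y} → blk P j y → blk P i y
blk-transport P {i} {j} {x} ix jx {y} = Equivalence.from (disjoint P i j x ix jx y)

≤ₚ-refl : {U : Set} (P : Partition U) → P ≤ₚ P
≤ₚ-refl P i = i , λ _ ix → ix

Indep-of-finer : {U : Set} (P₁ P₂ P : Partition U) → P₂ ≤ₚ P → Indep P₁ P₂ P
Indep-of-finer P₁ P₂ P P₂≤P b b₁ b₂ (x , b₁x , bx) (y , b₂y , by)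
  with P₂≤P b
... | k , b⊆k = x , b₁x , blk-transport P₂ b₂y (b⊆k y by) (b⊆k x bx) , bx

Indep-sym : {U : Set} (P₁ P₂ P : Partition U) → Indep P₁ P₂ P → Indep P₂ P₁ P
Indep-sym P₁ P₂ P H b b₂ b₁ meet₂ meet₁ with H b b₁ b₂ meet₁ meet₂
... | z , b₁z , b₂z , bz = z , b₂z , b₁z , bz

Indep-coarsenʳ : {U : Set} (P₁ P₂ P Q : Partition U) →
  Indep P₁ P₂ P → Q ≤ₚ P₂ → Indep P₁ Q P
Indep-coarsenʳ P₁ P₂ P Q H Q≤P₂ b b₁ q meet₁ (y , qy , by)
  with cover P₂ y
... | i , iy with Q≤P₂ i | H b b₁ i meet₁ (y , iy , by)
... | k , i⊆k | z , b₁z , iz , bz =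
  z , b₁z , blk-transport Q qy (i⊆k y iy) (i⊆k z iz) , bz

Indep-∨ʳ : {U : Set} (P₁ P₂ P : Partition U) →
  Indep P₁ P₂ P → Indep P₁ (P₂ ∨ₚ P) P
Indep-∨ʳ P₁ P₂ P H b b₁ ((i , j) , _) meet₁ (y , (iy , jy) , by)
  with H b b₁ i meet₁ (y , iy , by)
... | z , b₁z , iz , bz = z , b₁z , (iz , blk-transport P jy by bz) , bz

mainTheorem5 : {U : Set} → U → (P₁ P₂ P Q : Partition U) →
    Indep P₁ P₂ P₂
    × (Indep P₁ P₂ P → Indep P₂ P₁ P)
    × (Indep P₁ P₂ P → Q ≤ₚ P₂ → Indep P₁ Q P)
    × (Indep P₁ P₂ P → Indep P₁ (P₂ ∨ₚ P) P)
-- None of the four properties needs U to be nonempty.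
mainTheorem5 _ P₁ P₂ P Q =
    Indep-of-finer P₁ P₂ P₂ (≤ₚ-refl P₂)
  , Indep-sym P₁ P₂ P
  , Indep-coarsenʳ P₁ P₂ P Q
  , Indep-∨ʳ P₁ P₂ P
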